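{- Every column-convex (hexagonal-celled) polyomino is a multi-directed animal.
   Context: Work in the regular hexagonal tiling of the plane, oriented so that every hexagonal cell has two horizontal edges; thus each cell has an upper, a lower, an upper-left, an upper-right, a lower-left and a lower-right neighbour. A polyomino is a union of finitely many cells whose interior is connected. The column partition of a polyomino $P$ groups the cells of $P$ according to their horizontal projection (projection onto the horizontal axis); each block is a column of $P$. $P$ is column-convex if every column of $P$ is a connected set. A cell $c$ is a generalized upper neighbour of a cell $d$ if $c$ is the upper-left, upper, or upper-right neighbour of $d$. Directed animals are defined recursively: a single cell is a directed animal; a union $B$ of $n\ge 2$ cells is a directed animal iff $B=A\cup c$ where $A$ is a directed animal with $n-1$ cells and $c$ is a generalized upper neighbour of some cell of $A$. In a directed animal $A$ there is exactly one cell that is not a generalized upper neighbour of any cell of $A$; it is the source cell of $A$. A cell $c$ dominates over a cell $d$ if, for some integer $i\ge 0$, $c$ is obtained from a generalized upper neighbour of $d$ by translating it vertically upward by $i$ cell heights (i.e. $c$ lies $i$ units above a generalized upper neighbour of $d$). If $P,Q$ are polyominoes (or unions of cells) with no common cell, $P$ dominates over $Q$ if some cell of $P$ dominates over some cell of $Q$, but no cell of $Q$ dominates over any cell of $P$. A polyomino $P$ is a multi-directed animal if there exist $k\in\mathbb{N}$ and directed animals $A_1,\dots,A_k$, pairwise without common cells, such that: (1) $P=\bigcup_{i=1}^k A_i$; (2) for each $j\in\{2,\dots,k\}$, the horizontal projection of the source cell of $A_{j-1}$ lies to the left of (and does not intersect) the horizontal projection of $A_j$; (3) for each $j\in\{2,\dots,k\}$,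 the union $\bigcup_{i=1}^{j-1}A_i$ dominates over $A_j$; (4) for each $j\in\{2,\dots,k\}$, the union $\bigcup_{i=1}^{j-1}A_i$ and $A_j$ have at least one edge in common. -}

module Defs where

open import Data.Nat using (ℕ; suc)
open import Data.Integer using (ℤ; +_; _+_; _-_; _*_; _<_)
open import Data.Fin using (Fin; toℕ)
import Data.Nat as N
open import Data.Product using (Σ; _×_; _,_; ∃; ∃₂; proj₁; proj₂)
open import Data.Sum using (_⊎_)
open import Data.List using (List; []; _∷_)
open import Data.List.Membership.Propositional using (_∈_; _∉_)
open import Relation.Binary.PropositionalEquality using (_≡_; _≢_)
open import Relation.Nullary using (¬_)

-- Cells of the hexagonal tiling (flat-topped hexagons, i.e. every cell
-- has two horizontal edges), in axial coordinates (q , r):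
--   q = column index (cells with the same q have the same horizontal
--       projection; column q projects, in units of half an edge length,
--       onto the closed interval [3q - 2 , 3q + 2]),
--   the centre of (q , r) has height 2r + q (in units of half a cell height).

Cell : Set
Cell = ℤ × ℤ

col : Cell → ℤ
col = proj₁

up upRight upLeft : Cell → Cell
up      (q , r) = (q , r + + 1)
upRight (q , r) = (q + + 1 , r)
upLeft  (q , r) = (q - + 1 , r + + 1)

shiftUp : ℕ → Cell → Cell
shiftUp i (q , r) = (q , r + + i)

GenUpper : Cell → Cell → Set
GenUpper c d = (c ≡ upLeft d) ⊎ (c ≡ up d) ⊎ (c ≡ upRight d)

Adjacent : Cell → Cell → Set
Adjacent c d = GenUpper c d ⊎ GenUpper d c

Dominates : Cell → Cell → Set
Dominates c d = Σ ℕ λ i → Σ Cell λ u → GenUpper u d × (c ≡ shiftUp i u)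

CellSet : Set₁
CellSet = Cell → Set

data Path (S : CellSet) : Cell → Cell → Set where
  here : ∀ {c} → Path S c c
  step : ∀ {c c' d} → Adjacent c c' → S c' → Path S c' d → Path S c d

-- a union of cells has connected interior iff any two of its cells are
-- joined by a path of edge-adjacent cells of the set
Connected : CellSet → Set
Connected S = ∀ c d → S c → S d → Path S c d

IsPolyomino : List Cell → Set
IsPolyomino P = (∃ λ c → c ∈ P) × Connected (λ c → c ∈ P)

Column : List Cell → ℤ → CellSet
Column P x c = (c ∈ P) × (col c ≡ x)

ColumnConvex : List Cell → Set
ColumnConvex P = ∀ x → Connected (Column P x)

-- Directed animals (recursive definition; the list enumerates the cells,
-- head = last added cell)

data DA : List Cell → Set where
  single : ∀ c → DA (c ∷ [])
  grow   : ∀ {A c d} → DA A → c ∉ A → d ∈ A → GenUpper c d → DA (c ∷ A)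

SameSet : List Cell → List Cell → Set
SameSet A B = ∀ c → ((c ∈ A → c ∈ B) × (c ∈ B → c ∈ A))

IsDirectedAnimal : List Cell → Set
IsDirectedAnimal B = Σ (List Cell) λ A → DA A × SameSet A B

IsSource : List Cell → Cell → Set
IsSource A s = (s ∈ A) × (∀ d → d ∈ A → ¬ GenUpper s d)

-- horizontal projection of the cell s lies (strictly) to the left of, and
-- does not meet, the horizontal projection of the cell c
-- (projection of column q is [3q - 2 , 3q + 2])
ProjLeftOf : Cell → Cell → Set
ProjLeftOf s c = (+ 3 * col s + + 2) < (+ 3 * col c - + 2)

DominatesSet : CellSet → CellSet → Set
DominatesSet S T =
  (∃₂ λ c d → S c × T d × Dominates c d) ×
  ¬ (∃₂ λ c d → T c × S d × Dominates c d)

ShareEdge : CellSet → CellSet → Set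
ShareEdge S T = ∃₂ λ c d → S c × T d × Adjacent c d

-- Animals are indexed by Fin k (0-based), so the
-- paper's A_1 , … , A_k are A 0 , … , A (k-1), and "j ∈ {2,…,k}, with
-- A_{j-1}" becomes "i j : Fin k with suc (toℕ i) ≡ toℕ j".

IsMultiDirected : List Cell → Set
IsMultiDirected P =
  Σ ℕ λ k → Σ (Fin k → List Cell) λ A →
    (∀ i → IsDirectedAnimal (A i)) ×
    (∀ i j → i ≢ j → ∀ c → c ∈ A i → c ∉ A j) ×
    (∀ c → ((c ∈ P → ∃ λ i → c ∈ A i) × ((∃ λ i → c ∈ A i) → c ∈ P))) ×
    (∀ i j → suc (toℕ i) ≡ toℕ j →
       ∀ s → IsSource (A i) s → ∀ c → c ∈ A j → ProjLeftOf s c) ×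
    (∀ j → 1 N.≤ toℕ j →
       DominatesSet (λ c → ∃ λ i → (toℕ i N.< toℕ j) × (c ∈ A i))
                    (λ c → c ∈ A j)) ×
    (∀ j → 1 N.≤ toℕ j →
       ShareEdge (λ c → ∃ λ i → (toℕ i N.< toℕ j) × (c ∈ A i))
                 (λ c → c ∈ A j))

-- The minimal cells of P (no lower, lower-left or lower-right neighbour in P) serve as sources.
-- Columns of P are intervals, so each column holds at most one minimal cell; list them from left to
-- right as s₀ , … , s_{k-1}.  The j-th animal consists of the cells reachable from s_j by upward steps
-- inside P but from no earlier source; it is a directed animal with source s_j.  Two facts about
-- column-convex polyominoes give conditions (2)-(4):
-- * if a cell c of P dominates a cell d of P then c is reachable from d, because adjacent columns are
--   touching intervals; so no cell of a later animal dominates a cell of an earlier one;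
-- * a greedy descent from a cell at most one column right of a minimal cell m ends at a minimal cell
--   not right of m.  Hence each animal lies at least two columns right of the previous source, and at
--   the leftmost column of the j-th animal some cell is adjacent to, and dominated by, an earlier one.

module Submission where

open import Defs
open import Data.Nat as ℕ using (ℕ; zero; suc)
import Data.Nat.Properties as ℕP
open import Data.Integer as ℤ using (ℤ; +_; _+_; _-_; _<_; _≤_; -_)
import Data.Integer.Properties as ℤP
open import Data.Integer.Tactic.RingSolver using (solve-∀)
open import Data.Product using (_×_; _,_; ∃; ∃₂; proj₁; proj₂)
open import Data.Product.Properties using (≡-dec)
open import Data.Sum using (_⊎_; inj₁; inj₂)
open import Data.Empty using (⊥; ⊥-elim)
open import Data.Fin as Fin using (Fin; toℕ) renaming (zero to fzero; suc to fsuc)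
import Data.Fin.Properties as FinP
open import Data.List using (List; []; _∷_; length; filter; foldr; lookup)
import Data.List.Properties as ListP
import Data.List.Extrema ℤP.≤-totalOrder as Extrema
open import Data.List.Relation.Unary.All as All using ([]; _∷_)
open import Data.List.Relation.Unary.Any as Any using (here; there; any?)
import Data.List.Relation.Unary.Any.Properties as AnyP
open import Data.List.Relation.Unary.AllPairs using (AllPairs; []; _∷_)
open import Data.List.Membership.Propositional using (_∈_; _∉_; find; lose)
open import Data.List.Membership.Propositional.Properties using (∈-filter⁺; ∈-filter⁻; ∈-lookup)
open import Relation.Nullary using (¬_; Dec; yes; no)
open import Relation.Nullary.Decidable using (¬?; _×-dec_; decidable-stable)
open import Relation.Binary.Definitions using (DecidableEquality; tri<; tri≈; tri>)
open import Relation.Binary.PropositionalEquality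

i-1+1≡i : ∀ i → i - + 1 + + 1 ≡ i
i-1+1≡i = solve-∀

i+1-1≡i : ∀ i → i + + 1 - + 1 ≡ i
i+1-1≡i = solve-∀

i≤i+1 : ∀ i → i ≤ i + + 1
i≤i+1 i = ℤP.i≤i+j i (+ 1)

<⇒+1≤ : ∀ {i j} → i < j → i + + 1 ≤ j
<⇒+1≤ {i} {j} i<j = subst (_≤ j) (ℤP.+-comm (+ 1) i) (ℤP.i<j⇒suc[i]≤j i<j)

+1≤⇒< : ∀ {i j} → i + + 1 ≤ j → i < j
+1≤⇒< {i} {j} i+1≤j = ℤP.suc[i]≤j⇒i<j (subst (_≤ j) (ℤP.+-comm i (+ 1)) i+1≤j)

i<i+1 : ∀ i → i < i + + 1
i<i+1 i = +1≤⇒< ℤP.≤-refl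

i-1<i : ∀ i → i - + 1 < i
i-1<i i = +1≤⇒< (ℤP.≤-reflexive (i-1+1≡i i))

≰⇒+1≤ : ∀ {i j} → ¬ (j ≤ i) → i + + 1 ≤ j
≰⇒+1≤ j≰i = <⇒+1≤ (ℤP.≰⇒> j≰i)

<⇒≤-1 : ∀ {i j} → i < j → i ≤ j - + 1
<⇒≤-1 {i} {j} i<j = subst (_≤ j - + 1) (i+1-1≡i i) (ℤP.+-monoˡ-≤ (- + 1) (<⇒+1≤ i<j))

+1-cancel-≤ : ∀ {i j} → i + + 1 ≤ j + + 1 → i ≤ j
+1-cancel-≤ {i} {j} p = subst₂ _≤_ (i+1-1≡i i) (i+1-1≡i j) (ℤP.+-monoˡ-≤ (- + 1) p)

≤⇒≡+ : ∀ {i j} → i ≤ j → ∃ λ n → j ≡ i + + n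
≤⇒≡+ {i} {j} i≤j = ℤ.∣ j - i ∣ , (begin
  j                  ≡⟨ j≡i+[j-i] i j ⟩
  i + (j - i)        ≡⟨ cong (λ x → i + x) (ℤP.0≤i⇒+∣i∣≡i (ℤP.i≤j⇒0≤j-i i≤j)) ⟨
  i + + ℤ.∣ j - i ∣  ∎)
  where
  open ≡-Reasoning
  j≡i+[j-i] : ∀ i j → j ≡ i + (j - i)
  j≡i+[j-i] = solve-∀

i+suc[n]≡i+n+1 : ∀ i n → i + + suc n ≡ i + + n + + 1
i+suc[n]≡i+n+1 i n = lemma i (+ n)
  where
  lemma : ∀ i j → i + (+ 1 + j) ≡ i + j + + 1
  lemma = solve-∀

fuel-step : ∀ {i j} b n → i < j → j ≤ b + + suc n → i ≤ b + + n
fuel-step {i} {j} b n i<j j≤b+1+n =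
  +1-cancel-≤ (ℤP.≤-trans (<⇒+1≤ i<j) (ℤP.≤-trans j≤b+1+n (ℤP.≤-reflexive (i+suc[n]≡i+n+1 b n))))

intervals-meet : (I J : ℤ → Set) → (∀ t → Dec (I t)) →
  (∀ {p q t} → I p → I q → p ≤ t → t ≤ q → I t) →
  (∀ {p q t} → J p → J q → p ≤ t → t ≤ q → J t) →
  ∀ {r s a b} → r ≤ s → I r → J s → I a → J b → b ≤ a →
  ∃ λ t → r ≤ t × t ≤ s × I t × J t
intervals-meet I J I? convI convJ {r} {s} {a} r≤s Ir Js Ia Jb b≤a with I? s | s ℤ.≤? a | r ℤ.≤? a
... | yes Is | _     | _     = s , r≤s , ℤP.≤-refl , Is , Js
... | no ¬Is | yes s≤a | _   = ⊥-elim (¬Is (convI Ir Ia r≤s s≤a))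
... | no _   | no s≰a | yes r≤a =
  a , r≤a , ℤP.<⇒≤ (ℤP.≰⇒> s≰a) , Ia , convJ Jb Js b≤a (ℤP.<⇒≤ (ℤP.≰⇒> s≰a))
... | no _   | no _   | no r≰a =
  r , ℤP.≤-refl , r≤s , Ir , convJ Jb Js (ℤP.≤-trans b≤a (ℤP.<⇒≤ (ℤP.≰⇒> r≰a))) r≤s

first-crossing : (Q : ℕ → Set) → (∀ m → Dec (Q m)) → ∀ n → ¬ Q 0 → Q n →
  ∃ λ m → m ℕ.< n × ¬ Q m × Q (suc m)
first-crossing Q Q? zero    ¬Q0 Q0 = ⊥-elim (¬Q0 Q0)
first-crossing Q Q? (suc n) ¬Q0 Qn+1 with Q? n
... | no ¬Qn = n , ℕP.≤-refl , ¬Qn , Qn+1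
... | yes Qn with first-crossing Q Q? n ¬Q0 Qn
...   | m , m<n , ¬Qm , Qm+1 = m , ℕP.m≤n⇒m≤1+n m<n , ¬Qm , Qm+1

projections-apart : ∀ x y → x + + 1 + + 1 ≤ y → + 3 ℤ.* x + + 2 < + 3 ℤ.* y - + 2
projections-apart x y x+2≤y =
  ℤP.<-≤-trans (i<i+1 _) (ℤP.≤-trans (ℤP.≤-trans (i≤i+1 _) (ℤP.≤-reflexive (rearrange x)))
  (ℤP.+-monoˡ-≤ (- + 2) (ℤP.*-monoˡ-≤-nonNeg (+ 3) x+2≤y)))
  where
  rearrange : ∀ x → + 3 ℤ.* x + + 2 + + 1 + + 1 ≡ + 3 ℤ.* (x + + 1 + + 1) - + 2
  rearrange = solve-∀

suc-toℕ-pred : ∀ {n} (j : Fin n) → 1 ℕ.≤ toℕ j → suc (toℕ (Fin.pred j)) ≡ toℕ j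
suc-toℕ-pred (fsuc j) _ = cong suc (FinP.toℕ-inject₁ j)

lowerBound : ∀ {A : Set} (f : A → ℤ) (xs : List A) → ∃ λ b → ∀ {x} → x ∈ xs → b ≤ f x
lowerBound f []       = + 0 , λ ()
lowerBound f (x ∷ xs) with lowerBound f xs
... | b , b≤ = b ℤ.⊓ f x , λ { (here refl) → ℤP.i⊓j≤j b (f x)
                             ; (there y∈xs) → ℤP.≤-trans (ℤP.i⊓j≤i b (f x)) (b≤ y∈xs) }

argmin∈ : ∀ {A : Set} (f : A → ℤ) {x} xs → x ∈ xs → Extrema.argmin f x xs ∈ xs
argmin∈ f {x} xs x∈xs with Extrema.argmin-sel f x xs
... | inj₁ eq = subst (_∈ xs) (sym eq) x∈xs
... | inj₂ m  = m

argmax∈ : ∀ {A : Set} (f : A → ℤ) {x} xs → x ∈ xs → Extrema.argmax f x xs ∈ xs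
argmax∈ f {x} xs x∈xs with Extrema.argmax-sel f x xs
... | inj₁ eq = subst (_∈ xs) (sym eq) x∈xs
... | inj₂ m  = m

record Enumeration {A : Set} (key : A → ℤ) (xs : List A) : Set where
  field
    size       : ℕ
    at         : Fin size → A
    at∈        : ∀ i → at i ∈ xs
    increasing : ∀ i j → toℕ i ℕ.< toℕ j → key (at i) < key (at j)
    covers     : ∀ {x} → x ∈ xs → ∃ λ i → key (at i) ≡ key x

module _ {A : Set} (key : A → ℤ) where

  private
    _≺_ : A → A → Set
    x ≺ y = key x < key y

  -- keeps at most one element per key
  insertByKey : A → List A → List A
  insertByKey x [] = x ∷ []
  insertByKey x (y ∷ ys) with ℤP.<-cmp (key x) (key y)
  ... | tri< _ _ _ = x ∷ y ∷ ys
  ... | tri≈ _ _ _ = y ∷ ys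
  ... | tri> _ _ _ = y ∷ insertByKey x ys

  sortByKey : List A → List A
  sortByKey = foldr insertByKey []

  insertByKey⁻ : ∀ {z x} ys → z ∈ insertByKey x ys → z ≡ x ⊎ z ∈ ys
  insertByKey⁻ [] (here eq) = inj₁ eq
  insertByKey⁻ {x = x} (y ∷ ys) z∈ with ℤP.<-cmp (key x) (key y) | z∈
  ... | tri< _ _ _ | here eq     = inj₁ eq
  ... | tri< _ _ _ | there z∈ys  = inj₂ z∈ys
  ... | tri≈ _ _ _ | z∈ys        = inj₂ z∈ys
  ... | tri> _ _ _ | here eq     = inj₂ (here eq)
  ... | tri> _ _ _ | there z∈ins with insertByKey⁻ ys z∈ins
  ...   | inj₁ eq   = inj₁ eq
  ...   | inj₂ z∈ys = inj₂ (there z∈ys)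

  insertByKey⁺ : ∀ {z x} ys → z ∈ ys → z ∈ insertByKey x ys
  insertByKey⁺ {x = x} (y ∷ ys) z∈ with ℤP.<-cmp (key x) (key y) | z∈
  ... | tri< _ _ _ | z∈ys       = there z∈ys
  ... | tri≈ _ _ _ | z∈ys       = z∈ys
  ... | tri> _ _ _ | here eq    = here eq
  ... | tri> _ _ _ | there z∈ys = there (insertByKey⁺ ys z∈ys)

  insertByKey-key : ∀ x ys → ∃ λ z → z ∈ insertByKey x ys × key z ≡ key x
  insertByKey-key x [] = x , here refl , refl
  insertByKey-key x (y ∷ ys) with ℤP.<-cmp (key x) (key y)
  ... | tri< _ _ _   = x , here refl , refl
  ... | tri≈ _ eq _  = y , here refl , sym eq
  ... | tri> _ _ _ with insertByKey-key x ys
  ...   | z , z∈ , eq = z , there z∈ , eq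

  insertByKey-sorted : ∀ x ys → AllPairs _≺_ ys → AllPairs _≺_ (insertByKey x ys)
  insertByKey-sorted x [] _ = [] ∷ []
  insertByKey-sorted x (y ∷ ys) (y≺ys ∷ sorted) with ℤP.<-cmp (key x) (key y)
  ... | tri< x≺y _ _ = (x≺y ∷ All.map (ℤP.<-trans x≺y) y≺ys) ∷ y≺ys ∷ sorted
  ... | tri≈ _ _ _   = y≺ys ∷ sorted
  ... | tri> _ _ y≺x = All.tabulate y≺ins ∷ insertByKey-sorted x ys sorted
    where
    y≺ins : ∀ {z} → z ∈ insertByKey x ys → y ≺ z
    y≺ins z∈ with insertByKey⁻ ys z∈
    ... | inj₁ refl = y≺x
    ... | inj₂ z∈ys = All.lookup y≺ys z∈ys

  sortByKey⁻ : ∀ {z} xs → z ∈ sortByKey xs → z ∈ xs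
  sortByKey⁻ (x ∷ xs) z∈ with insertByKey⁻ (sortByKey xs) z∈
  ... | inj₁ eq = here eq
  ... | inj₂ z∈sorted = there (sortByKey⁻ xs z∈sorted)

  sortByKey-key : ∀ {x} xs → x ∈ xs → ∃ λ z → z ∈ sortByKey xs × key z ≡ key x
  sortByKey-key (x ∷ xs) (here refl) = insertByKey-key x (sortByKey xs)
  sortByKey-key (x ∷ xs) (there y∈xs) with sortByKey-key xs y∈xs
  ... | z , z∈ , eq = z , insertByKey⁺ (sortByKey xs) z∈ , eq

  sortByKey-sorted : ∀ xs → AllPairs _≺_ (sortByKey xs)
  sortByKey-sorted [] = []
  sortByKey-sorted (x ∷ xs) = insertByKey-sorted x (sortByKey xs) (sortByKey-sorted xs)

  lookup-increasing : ∀ {ys} → AllPairs _≺_ ys → ∀ i j → toℕ i ℕ.< toℕ j → lookup ys i ≺ lookup ys j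
  lookup-increasing (y≺ys ∷ _)      fzero    (fsuc j) _           = All.lookup y≺ys (∈-lookup j)
  lookup-increasing (_ ∷ sorted)    (fsuc i) (fsuc j) (ℕ.s≤s i<j) = lookup-increasing sorted i j i<j

  enumerate : ∀ xs → Enumeration key xs
  enumerate xs = record
    { size       = length (sortByKey xs)
    ; at         = lookup (sortByKey xs)
    ; at∈        = λ i → sortByKey⁻ xs (∈-lookup i)
    ; increasing = lookup-increasing (sortByKey-sorted xs)
    ; covers     = covers
    }
    where
    covers : ∀ {x} → x ∈ xs → ∃ λ i → key (lookup (sortByKey xs) i) ≡ key x
    covers x∈xs with sortByKey-key xs x∈xs
    ... | z , z∈ , eq = Any.index z∈ , trans (cong key (sym (AnyP.lookup-index z∈))) eq

row : Cell → ℤ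
row = proj₂

height : Cell → ℤ
height (q , r) = q + (r + r)

down downLeft downRight : Cell → Cell
down      (q , r) = (q , r - + 1)
downLeft  (q , r) = (q - + 1 , r)
downRight (q , r) = (q + + 1 , r - + 1)

_≟ᶜ_ : DecidableEquality Cell
_≟ᶜ_ = ≡-dec ℤ._≟_ ℤ._≟_

GenUpper-down : ∀ c → GenUpper c (down c)
GenUpper-down (q , r) = inj₂ (inj₁ (cong (q ,_) (sym (i-1+1≡i r))))

GenUpper-downLeft : ∀ c → GenUpper c (downLeft c)
GenUpper-downLeft (q , r) = inj₂ (inj₂ (cong (_, r) (sym (i-1+1≡i q))))

GenUpper-downRight : ∀ c → GenUpper c (downRight c)
GenUpper-downRight (q , r) = inj₁ (cong₂ _,_ (sym (i+1-1≡i q)) (sym (i-1+1≡i r)))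

GenUpper⇒lower : ∀ {c l} → GenUpper c l → l ≡ downRight c ⊎ l ≡ down c ⊎ l ≡ downLeft c
GenUpper⇒lower {l = q , r} (inj₁ refl)        = inj₁ (cong₂ _,_ (sym (i-1+1≡i q)) (sym (i+1-1≡i r)))
GenUpper⇒lower {l = q , r} (inj₂ (inj₁ refl)) = inj₂ (inj₁ (cong (q ,_) (sym (i+1-1≡i r))))
GenUpper⇒lower {l = q , r} (inj₂ (inj₂ refl)) = inj₂ (inj₂ (cong (_, r) (sym (i+1-1≡i q))))

GenUpper⇒height< : ∀ {c l} → GenUpper c l → height l < height c
GenUpper⇒height< {l = q , r} (inj₁ refl)        = +1≤⇒< (ℤP.≤-reflexive (upLeft-height q r))
  where
  upLeft-height : ∀ q r → q + (r + r) + + 1 ≡ q - + 1 + ((r + + 1) + (r + + 1))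
  upLeft-height = solve-∀
GenUpper⇒height< {l = q , r} (inj₂ (inj₁ refl)) =
  ℤP.<-trans (i<i+1 _) (+1≤⇒< (ℤP.≤-reflexive (up-height q r)))
  where
  up-height : ∀ q r → q + (r + r) + + 1 + + 1 ≡ q + ((r + + 1) + (r + + 1))
  up-height = solve-∀
GenUpper⇒height< {l = q , r} (inj₂ (inj₂ refl)) = +1≤⇒< (ℤP.≤-reflexive (upRight-height q r))
  where
  upRight-height : ∀ q r → q + (r + r) + + 1 ≡ q + + 1 + (r + r)
  upRight-height = solve-∀

Adjacent⇒col≤col+1 : ∀ {c d} → Adjacent c d → col d ≤ col c + + 1
Adjacent⇒col≤col+1 {q , r} (inj₁ (inj₁ refl))        = ℤP.≤-reflexive (sym (i-1+1≡i _))
Adjacent⇒col≤col+1 {q , r} (inj₁ (inj₂ (inj₁ refl))) = i≤i+1 _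
Adjacent⇒col≤col+1 {q , r} (inj₁ (inj₂ (inj₂ refl))) = ℤP.≤-trans (i≤i+1 _) (i≤i+1 _)
Adjacent⇒col≤col+1 {q , r} (inj₂ (inj₁ refl))        = ℤP.≤-trans (ℤP.<⇒≤ (i-1<i q)) (i≤i+1 q)
Adjacent⇒col≤col+1 {q , r} (inj₂ (inj₂ (inj₁ refl))) = i≤i+1 q
Adjacent⇒col≤col+1 {q , r} (inj₂ (inj₂ (inj₂ refl))) = ℤP.≤-refl

Adjacent-sameCol⇒row≤row+1 : ∀ {c d} → Adjacent c d → col c ≡ col d → row d ≤ row c + + 1
Adjacent-sameCol⇒row≤row+1 (inj₁ (inj₁ refl))        eq = ⊥-elim (ℤP.<⇒≢ (i-1<i _) eq)
Adjacent-sameCol⇒row≤row+1 (inj₁ (inj₂ (inj₁ refl))) eq = ℤP.≤-trans (i≤i+1 _) (i≤i+1 _)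
Adjacent-sameCol⇒row≤row+1 (inj₁ (inj₂ (inj₂ refl))) eq = ⊥-elim (ℤP.<⇒≢ (i<i+1 _) (sym eq))
Adjacent-sameCol⇒row≤row+1 (inj₂ (inj₁ refl))        eq = ⊥-elim (ℤP.<⇒≢ (i-1<i _) (sym eq))
Adjacent-sameCol⇒row≤row+1 (inj₂ (inj₂ (inj₁ refl))) eq = ℤP.≤-refl
Adjacent-sameCol⇒row≤row+1 (inj₂ (inj₂ (inj₂ refl))) eq = ⊥-elim (ℤP.<⇒≢ (i<i+1 _) eq)

Adjacent-nextCol⇒row : ∀ {u v} → Adjacent u v → col v ≡ col u + + 1 →
  row v ≡ row u ⊎ row u ≡ row v + + 1
Adjacent-nextCol⇒row (inj₁ (inj₁ refl))                    eq = inj₂ refl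
Adjacent-nextCol⇒row (inj₁ (inj₂ (inj₁ refl)))             eq = ⊥-elim (ℤP.<⇒≢ (i<i+1 _) eq)
Adjacent-nextCol⇒row {v = q , r} (inj₁ (inj₂ (inj₂ refl))) eq =
  ⊥-elim (ℤP.<⇒≢ (ℤP.<-trans (i<i+1 q) (i<i+1 _)) eq)
Adjacent-nextCol⇒row {u = q , r} (inj₂ (inj₁ refl))        eq =
  ⊥-elim (ℤP.<⇒≢ (ℤP.<-trans (i-1<i q) (i<i+1 q)) eq)
Adjacent-nextCol⇒row (inj₂ (inj₂ (inj₁ refl)))             eq = ⊥-elim (ℤP.<⇒≢ (i<i+1 _) eq)
Adjacent-nextCol⇒row (inj₂ (inj₂ (inj₂ refl)))             eq = inj₁ refl

Rooted : List Cell → Cell → Set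
Rooted S s = IsSource S s × (∀ c → c ∈ S → c ≢ s → ∃ λ l → l ∈ S × GenUpper c l)

rooted-source : ∀ {S s s′} → Rooted S s → IsSource S s′ → s′ ≡ s
rooted-source {s = s} {s′} (_ , descends) (s′∈S , s′-lowest) with s′ ≟ᶜ s
... | yes eq  = eq
... | no s′≢s with descends s′ s′∈S s′≢s
... | l , l∈S , s′>l = ⊥-elim (s′-lowest l l∈S s′>l)

remove : Cell → List Cell → List Cell
remove t = filter (λ c → ¬? (c ≟ᶜ t))

∈-remove⁺ : ∀ {c t S} → c ∈ S → c ≢ t → c ∈ remove t S
∈-remove⁺ {t = t} = ∈-filter⁺ (λ c → ¬? (c ≟ᶜ t))

∈-remove⁻ : ∀ {c t} S → c ∈ remove t S → c ∈ S × c ≢ t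
∈-remove⁻ {t = t} S = ∈-filter⁻ (λ c → ¬? (c ≟ᶜ t)) {xs = S}

remove-shorter : ∀ {t S} → t ∈ S → length (remove t S) ℕ.< length S
remove-shorter {t} {S} t∈S =
  ListP.filter-notAll (λ c → ¬? (c ≟ᶜ t)) S (Any.map (λ t≡c c≢t → c≢t (sym t≡c)) t∈S)

SameSet-∷-remove : ∀ {t A S} → t ∈ S → SameSet A (remove t S) → SameSet (t ∷ A) S
SameSet-∷-remove {t} {A} {S} t∈S A≈ c = to , from
  where
  to : c ∈ t ∷ A → c ∈ S
  to (here refl)  = t∈S
  to (there c∈A) = proj₁ (∈-remove⁻ S (proj₁ (A≈ c) c∈A))
  from : c ∈ S → c ∈ t ∷ A
  from c∈S with c ≟ᶜ t
  ... | yes c≡t = here c≡t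
  ... | no c≢t  = there (proj₂ (A≈ c) (∈-remove⁺ c∈S c≢t))

highest-nonRoot : ∀ S s → (∃ λ c → c ∈ S × c ≢ s) →
  ∃ λ t → t ∈ S × t ≢ s × (∀ {c} → c ∈ S → c ≢ s → height c ≤ height t)
highest-nonRoot S s (c₀ , c₀∈S , c₀≢s) =
  t , proj₁ (∈-remove⁻ S t∈others) , proj₂ (∈-remove⁻ S t∈others)
  , λ c∈S c≢s → All.lookup (Extrema.f[xs]≤f[argmax] c₀ (remove s S)) (∈-remove⁺ c∈S c≢s)
  where
  t = Extrema.argmax height c₀ (remove s S)
  t∈others = argmax∈ height (remove s S) (∈-remove⁺ c₀∈S c₀≢s)

remove-highest-rooted : ∀ {S s t} → Rooted S s → t ∈ S → t ≢ s →
  (∀ {c} → c ∈ S → c ≢ s → height c ≤ height t) →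
  Rooted (remove t S) s
remove-highest-rooted {S} {s} {t} ((s∈S , s-lowest) , descends) t∈S t≢s t-highest =
  (∈-remove⁺ s∈S (λ s≡t → t≢s (sym s≡t)) , λ d d∈rest → s-lowest d (proj₁ (∈-remove⁻ S d∈rest)))
  , lower-remains
  where
  lower≢t : ∀ {c l} → c ∈ S → GenUpper c l → l ≢ t
  lower≢t {c} c∈S c>t refl with c ≟ᶜ s
  ... | yes refl = s-lowest t t∈S c>t
  ... | no c≢s   = ℤP.<-irrefl refl (ℤP.<-≤-trans (GenUpper⇒height< c>t) (t-highest c∈S c≢s))
  lower-remains : ∀ c → c ∈ remove t S → c ≢ s → ∃ λ l → l ∈ remove t S × GenUpper c l
  lower-remains c c∈rest c≢s with descends c (proj₁ (∈-remove⁻ S c∈rest)) c≢s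
  ... | l , l∈S , c>l = l , ∈-remove⁺ l∈S (lower≢t (proj₁ (∈-remove⁻ S c∈rest)) c>l) , c>l

rooted⇒directedAnimal : ∀ S {s} → Rooted S s → IsDirectedAnimal S
rooted⇒directedAnimal S = go (length S) S ℕP.≤-refl
  where
  go : ∀ n S {s} → length S ℕ.≤ n → Rooted S s → IsDirectedAnimal S
  go n S {s} len rooted with any? (λ c → ¬? (c ≟ᶜ s)) S
  ... | no none =
    s ∷ [] , single s , λ c → (λ { (here refl) → proj₁ (proj₁ rooted) }) , λ c∈S → here (only-s c∈S)
    where
    only-s : ∀ {c} → c ∈ S → c ≡ s
    only-s {c} c∈S = decidable-stable (c ≟ᶜ s) (λ c≢s → none (lose c∈S c≢s))
  go zero (_ ∷ _) () _ | yes _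
  go (suc n) S {s} len rooted | yes some with highest-nonRoot S s (find some)
  ... | t , t∈S , t≢s , t-highest
    with go n (remove t S) (ℕP.≤-pred (ℕP.≤-trans (remove-shorter t∈S) len))
            (remove-highest-rooted rooted t∈S t≢s t-highest)
       | proj₂ rooted t t∈S t≢s
  ... | A′ , A′-animal , A′≈ | l , l∈S , t>l =
    t ∷ A′ , grow A′-animal (λ t∈A′ → proj₂ (∈-remove⁻ S (proj₁ (A′≈ t) t∈A′)) refl)
                 (proj₂ (A′≈ l) (∈-remove⁺ l∈S λ l≡t → ℤP.<-irrefl (cong height l≡t) (GenUpper⇒height< t>l)))
                 t>l
         , SameSet-∷-remove t∈S A′≈

module ColumnConvexPolyomino (P : List Cell) (connected : Connected (λ c → c ∈ P))
                             (convex : ColumnConvex P) where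

  open import Data.List.Membership.DecPropositional _≟ᶜ_ using (_∈?_)

  infix 4 _↗_

  data _↗_ (d : Cell) : Cell → Set where
    stay  : d ↗ d
    climb : ∀ {l c} → d ↗ l → c ∈ P → GenUpper c l → d ↗ c

  ↗-trans : ∀ {a b c} → a ↗ b → b ↗ c → a ↗ c
  ↗-trans a↗b stay              = a↗b
  ↗-trans a↗b (climb b↗l c∈P c>l) = climb (↗-trans a↗b b↗l) c∈P c>l

  ↗-∈ : ∀ {d c} → d ∈ P → d ↗ c → c ∈ P
  ↗-∈ d∈P stay          = d∈P
  ↗-∈ _   (climb _ c∈P _) = c∈P

  ↗-height : ∀ {d c} → d ↗ c → height d ≤ height c
  ↗-height stay              = ℤP.≤-refl
  ↗-height (climb d↗l _ c>l) = ℤP.≤-trans (↗-height d↗l) (ℤP.<⇒≤ (GenUpper⇒height< c>l))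

  ↗?-fuel : ∀ n d c → height c ≤ height d + + n → Dec (d ↗ c)
  ↗?-fuel n d c bound with c ≟ᶜ d
  ... | yes refl = yes stay
  ... | no c≢d with c ∈? P
  ... | no c∉P = no λ { stay → c≢d refl ; (climb _ c∈P _) → c∉P c∈P }
  ↗?-fuel zero d c bound | no c≢d | yes _ = no λ
    { stay → c≢d refl
    ; (climb d↗l _ c>l) → ℤP.<-irrefl refl (ℤP.≤-<-trans (↗-height d↗l)
        (ℤP.<-≤-trans (GenUpper⇒height< c>l) (ℤP.≤-trans bound (ℤP.≤-reflexive (ℤP.+-identityʳ _))))) }
  ↗?-fuel (suc n) d c bound | no c≢d | yes c∈P
    with ↗?-fuel n d (downRight c) (fuel-step (height d) n (GenUpper⇒height< (GenUpper-downRight c)) bound)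
       | ↗?-fuel n d (down c)      (fuel-step (height d) n (GenUpper⇒height< (GenUpper-down c)) bound)
       | ↗?-fuel n d (downLeft c)  (fuel-step (height d) n (GenUpper⇒height< (GenUpper-downLeft c)) bound)
  ... | yes d↗l | _       | _       = yes (climb d↗l c∈P (GenUpper-downRight c))
  ... | no _    | yes d↗l | _       = yes (climb d↗l c∈P (GenUpper-down c))
  ... | no _    | no _    | yes d↗l = yes (climb d↗l c∈P (GenUpper-downLeft c))
  ... | no ¬dr  | no ¬d   | no ¬dl  = no λ
    { stay → c≢d refl
    ; (climb d↗l _ c>l) → no-lower d↗l (GenUpper⇒lower c>l) }
    where
    no-lower : ∀ {l} → d ↗ l → l ≡ downRight c ⊎ l ≡ down c ⊎ l ≡ downLeft c → ⊥
    no-lower d↗l (inj₁ refl)        = ¬dr d↗l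
    no-lower d↗l (inj₂ (inj₁ refl)) = ¬d d↗l
    no-lower d↗l (inj₂ (inj₂ refl)) = ¬dl d↗l

  _↗?_ : ∀ d c → Dec (d ↗ c)
  d ↗? c with ℤP.≤-total (height c) (height d)
  ... | inj₁ c≤d = ↗?-fuel 0 d c (ℤP.≤-trans c≤d (ℤP.≤-reflexive (sym (ℤP.+-identityʳ _))))
  ... | inj₂ d≤c = ↗?-fuel (proj₁ (≤⇒≡+ d≤c)) d c (ℤP.≤-reflexive (proj₂ (≤⇒≡+ d≤c)))

  path-covers-rows : ∀ {x c d t} → Path (Column P x) c d → Column P x c →
    row c ≤ t → t ≤ row d → (x , t) ∈ P
  path-covers-rows {c = q , r} here (c∈P , refl) r≤t t≤r =
    subst (λ t → (q , t) ∈ P) (ℤP.≤-antisym r≤t t≤r) c∈P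
  path-covers-rows {c = q , r} {t = t} (step adj c′∈col path) (c∈P , refl) r≤t t≤d with r ℤ.≟ t
  ... | yes refl = c∈P
  ... | no r≢t   = path-covers-rows path c′∈col
    (ℤP.≤-trans (Adjacent-sameCol⇒row≤row+1 adj (sym (proj₂ c′∈col))) (<⇒+1≤ (ℤP.≤∧≢⇒< r≤t r≢t)))
    t≤d

  column-interval : ∀ {x a b t} → (x , a) ∈ P → (x , b) ∈ P → a ≤ t → t ≤ b → (x , t) ∈ P
  column-interval {x} {a} {b} a∈P b∈P =
    path-covers-rows (convex x (x , a) (x , b) (a∈P , refl) (b∈P , refl)) (a∈P , refl)

  column-↗ : ∀ {x a b} → (x , a) ∈ P → (x , b) ∈ P → a ≤ b → (x , a) ↗ (x , b)
  column-↗ {x} {a} a∈P b∈P a≤b with ≤⇒≡+ a≤b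
  ... | n , refl = go n b∈P
    where
    go : ∀ n → (x , a + + n) ∈ P → (x , a) ↗ (x , a + + n)
    go zero    _     = subst (λ r → (x , a) ↗ (x , r)) (sym (ℤP.+-identityʳ a)) stay
    go (suc n) top∈P = climb (go n mid∈P) top∈P (inj₂ (inj₁ (cong (x ,_) (i+suc[n]≡i+n+1 a n))))
      where
      mid∈P : (x , a + + n) ∈ P
      mid∈P = column-interval a∈P top∈P (ℤP.i≤i+j a (+ n)) (ℤP.+-monoʳ-≤ a (ℤ.+≤+ (ℕP.n≤1+n n)))

  crossing : ∀ {x c d} → Path (λ e → e ∈ P) c d → c ∈ P → col c ≤ x → x < col d →
    ∃₂ λ u v → u ∈ P × v ∈ P × col u ≡ x × col v ≡ x + + 1 × Adjacent u v
  crossing here _ c≤x x<c = ⊥-elim (ℤP.<-irrefl refl (ℤP.≤-<-trans c≤x x<c))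
  crossing {x} {c} (step {c' = c′} adj c′∈P path) c∈P c≤x x<d with col c′ ℤ.≤? x
  ... | yes c′≤x = crossing path c′∈P c′≤x x<d
  ... | no c′≰x  = c , c′ , c∈P , c′∈P
    , ℤP.≤-antisym c≤x (+1-cancel-≤ (ℤP.≤-trans (≰⇒+1≤ c′≰x) (Adjacent⇒col≤col+1 adj)))
    , ℤP.≤-antisym (ℤP.≤-trans (Adjacent⇒col≤col+1 adj) (ℤP.+-monoˡ-≤ (+ 1) c≤x)) (≰⇒+1≤ c′≰x)
    , adj

  columns-touch : ∀ {x c d} → c ∈ P → d ∈ P → col c ≤ x → x < col d →
    ∃₂ λ a b → (x , a) ∈ P × (x + + 1 , b) ∈ P × b ≤ a × a ≤ b + + 1
  columns-touch c∈P d∈P c≤x x<d with crossing (connected _ _ c∈P d∈P) c∈P c≤x x<d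
  ... | (_ , a) , (_ , b) , u∈P , v∈P , refl , refl , adj with Adjacent-nextCol⇒row adj refl
  ...   | inj₁ refl = a , a , u∈P , v∈P , ℤP.≤-refl , i≤i+1 a
  ...   | inj₂ refl = a , b , u∈P , v∈P , i≤i+1 b , ℤP.≤-refl

  -- Adjacent columns are intervals that touch, so they share a row t between r and r′:
  -- climb column x to t, step to the next column, and climb on.
  ↗-right : ∀ {x r r′} → (x , r) ∈ P → (x + + 1 , r′) ∈ P → r ≤ r′ → (x , r) ↗ (x + + 1 , r′)
  ↗-right {x} r∈P r′∈P r≤r′ with columns-touch {x} r∈P r′∈P ℤP.≤-refl (i<i+1 x)
  ... | a , b , a∈P , b∈P , b≤a , _
    with intervals-meet (λ t → (x , t) ∈ P) (λ t → (x + + 1 , t) ∈ P) (λ t → (x , t) ∈? P)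
           column-interval column-interval r≤r′ r∈P r′∈P a∈P b∈P b≤a
  ... | t , r≤t , t≤r′ , t∈P , t′∈P =
    ↗-trans (column-↗ r∈P t∈P r≤t)
      (↗-trans (climb stay t′∈P (inj₂ (inj₂ refl))) (column-↗ t′∈P r′∈P t≤r′))

  ↗-left : ∀ {x r r′} → (x , r) ∈ P → (x - + 1 , r′) ∈ P → r + + 1 ≤ r′ → (x , r) ↗ (x - + 1 , r′)
  ↗-left {x} {r} {r′} r∈P r′∈P r+1≤r′ with columns-touch {x - + 1} r′∈P r∈P ℤP.≤-refl (i-1<i x)
  ... | a , b , a∈P , b∈P , b≤a , a≤b+1
    with intervals-meet (λ t → (x , t) ∈ P) (λ t → (x - + 1 , t + + 1) ∈ P) (λ t → (x , t) ∈? P)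
           column-interval (λ p∈P q∈P p≤t t≤q → column-interval p∈P q∈P (+1-mono p≤t) (+1-mono t≤q))
           (<⇒≤-1 (+1≤⇒< r+1≤r′)) r∈P (cast-row r′∈P (i-1+1≡i r′))
           (subst (λ q → (q , b) ∈ P) (i-1+1≡i x) b∈P) (cast-row a∈P (i-1+1≡i a))
           (ℤP.≤-trans (ℤP.+-monoˡ-≤ (- + 1) a≤b+1) (ℤP.≤-reflexive (i+1-1≡i b)))
    where
    +1-mono : ∀ {p q} → p ≤ q → p + + 1 ≤ q + + 1
    +1-mono = ℤP.+-monoˡ-≤ (+ 1)
    cast-row : ∀ {p q} → (x - + 1 , q) ∈ P → p ≡ q → (x - + 1 , p) ∈ P
    cast-row q∈P refl = q∈P
  ... | t , r≤t , t≤r′-1 , t∈P , t′∈P =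
    ↗-trans (column-↗ r∈P t∈P r≤t) (↗-trans (climb stay t′∈P (inj₁ refl))
      (column-↗ t′∈P r′∈P
        (ℤP.≤-trans (ℤP.+-monoˡ-≤ (+ 1) t≤r′-1) (ℤP.≤-reflexive (i-1+1≡i r′)))))

  dominates⇒↗ : ∀ {c d} → c ∈ P → d ∈ P → Dominates c d → d ↗ c
  dominates⇒↗ {d = x , r} c∈P d∈P (i , _ , inj₁ refl , refl)        = ↗-left d∈P c∈P (ℤP.i≤i+j _ (+ i))
  dominates⇒↗ {d = x , r} c∈P d∈P (i , _ , inj₂ (inj₁ refl) , refl) =
    column-↗ d∈P c∈P (ℤP.≤-trans (i≤i+1 r) (ℤP.i≤i+j _ (+ i)))
  dominates⇒↗ {d = x , r} c∈P d∈P (i , _ , inj₂ (inj₂ refl) , refl) =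
    ↗-right d∈P c∈P (ℤP.i≤i+j r (+ i))

  IsMinimal : Cell → Set
  IsMinimal m = m ∈ P × down m ∉ P × downLeft m ∉ P × downRight m ∉ P

  isMinimal? : ∀ m → Dec (IsMinimal m)
  isMinimal? m = (m ∈? P) ×-dec ¬? (down m ∈? P) ×-dec ¬? (downLeft m ∈? P) ×-dec ¬? (downRight m ∈? P)

  minimal-no-lower : ∀ {m l} → IsMinimal m → l ∈ P → ¬ GenUpper m l
  minimal-no-lower (_ , no-down , no-downLeft , no-downRight) l∈P m>l with GenUpper⇒lower m>l
  ... | inj₁ refl        = no-downRight l∈P
  ... | inj₂ (inj₁ refl) = no-down l∈P
  ... | inj₂ (inj₂ refl) = no-downLeft l∈P

  ↗-minimal : ∀ {d m} → d ∈ P → IsMinimal m → d ↗ m → m ≡ d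
  ↗-minimal d∈P m-min stay              = refl
  ↗-minimal d∈P m-min (climb d↗l _ m>l) = ⊥-elim (minimal-no-lower m-min (↗-∈ d∈P d↗l) m>l)

  -- a column of P is an interval of rows, so its only possible minimal cell is its bottom cell
  minimal-unique : ∀ {m₁ m₂} → IsMinimal m₁ → IsMinimal m₂ → col m₁ ≡ col m₂ → m₁ ≡ m₂
  minimal-unique {x , r₁} {.x , r₂} m₁-min m₂-min refl with ℤP.<-cmp r₁ r₂
  ... | tri≈ _ r₁≡r₂ _ = cong (x ,_) r₁≡r₂
  ... | tri< r₁<r₂ _ _ =
    ⊥-elim (proj₁ (proj₂ m₂-min)
      (column-interval (proj₁ m₁-min) (proj₁ m₂-min) (<⇒≤-1 r₁<r₂) (ℤP.<⇒≤ (i-1<i r₂))))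
  ... | tri> _ _ r₂<r₁ =
    ⊥-elim (proj₁ (proj₂ m₁-min)
      (column-interval (proj₁ m₂-min) (proj₁ m₁-min) (<⇒≤-1 r₂<r₁) (ℤP.<⇒≤ (i-1<i r₁))))

  bottom≤ : ∀ {x t a} → (x , t) ∈ P → (x , t - + 1) ∉ P → (x , a) ∈ P → t ≤ a
  bottom≤ {t = t} {a} t∈P below∉P a∈P with t ℤ.≤? a
  ... | yes t≤a = t≤a
  ... | no t≰a  =
    ⊥-elim (below∉P (column-interval a∈P t∈P (<⇒≤-1 (ℤP.≰⇒> t≰a)) (ℤP.<⇒≤ (i-1<i t))))

  -- Column x + 1 meets column x, so its bottom row ρ lies between the bottom row L of column x
  -- and the rows where the two columns touch.
  bottom-right-of-minimal : ∀ {x L ρ} → IsMinimal (x , L) → (x + + 1 , ρ) ∈ P → (x + + 1 , ρ - + 1) ∉ P →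
    (x , ρ) ∈ P
  bottom-right-of-minimal {x} {L} {ρ} (L∈P , no-down , _ , no-downRight) ρ∈P below∉P
    with columns-touch {x} L∈P ρ∈P ℤP.≤-refl (i<i+1 x)
  ... | a , b , a∈P , b∈P , b≤a , a≤b+1 = column-interval L∈P a∈P L≤ρ (ℤP.≤-trans ρ≤b b≤a)
    where
    ρ≤b : ρ ≤ b
    ρ≤b = bottom≤ ρ∈P below∉P b∈P
    L≤ρ : L ≤ ρ
    L≤ρ with L ℤ.≤? ρ
    ... | yes L≤ρ = L≤ρ
    ... | no L≰ρ  = ⊥-elim (no-downRight (column-interval ρ∈P b∈P (<⇒≤-1 (ℤP.≰⇒> L≰ρ))
      (ℤP.≤-trans (ℤP.+-monoˡ-≤ (- + 1) (ℤP.≤-trans (bottom≤ L∈P no-down a∈P) a≤b+1))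
                  (ℤP.≤-reflexive (i+1-1≡i b)))))

  left-blocked⇒col≤ : ∀ {m c} → IsMinimal m → c ∈ P → down c ∉ P → downLeft c ∉ P →
    col c ≤ col m + + 1 → col c ≤ col m
  left-blocked⇒col≤ {x , L} {q , ρ} m-min c∈P no-down no-downLeft q≤x+1 with q ℤ.≤? x
  ... | yes q≤x = q≤x
  ... | no q≰x with ℤP.≤-antisym q≤x+1 (≰⇒+1≤ q≰x)
  ... | refl = ⊥-elim (no-downLeft (subst (λ p → (p , ρ) ∈ P) (sym (i+1-1≡i x))
                                       (bottom-right-of-minimal m-min c∈P no-down)))

  -- Preferring down and downLeft keeps the descent from drifting to the right (Descent-col).
  data Descent : Cell → Cell → Set where
    done         : ∀ {m} → IsMinimal m → Descent m m
    viaDown      : ∀ {c m} → down c ∈ P → Descent (down c) m → Descent c m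
    viaDownLeft  : ∀ {c m} → down c ∉ P → downLeft c ∈ P → Descent (downLeft c) m → Descent c m
    viaDownRight : ∀ {c m} → down c ∉ P → downLeft c ∉ P → downRight c ∈ P →
                   Descent (downRight c) m → Descent c m

  descent : ∀ {c} → c ∈ P → ∃ λ m → Descent c m
  descent {c} c∈P with lowerBound height P
  ... | b , b≤ = go (proj₁ (≤⇒≡+ (b≤ c∈P))) c c∈P (ℤP.≤-reflexive (proj₂ (≤⇒≡+ (b≤ c∈P))))
    where
    go : ∀ n c → c ∈ P → height c ≤ b + + n → ∃ λ m → Descent c m
    descend : ∀ n {c l} → height c ≤ b + + n → GenUpper c l → l ∈ P →
              (∀ {m} → Descent l m → Descent c m) → ∃ λ m → Descent c m
    go n c c∈P bound with down c ∈? P | downLeft c ∈? P | downRight c ∈? P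
    ... | yes d∈P | _        | _         = descend n bound (GenUpper-down c) d∈P (viaDown d∈P)
    ... | no nd   | yes dl∈P | _         = descend n bound (GenUpper-downLeft c) dl∈P (viaDownLeft nd dl∈P)
    ... | no nd   | no ndl   | yes dr∈P  = descend n bound (GenUpper-downRight c) dr∈P (viaDownRight nd ndl dr∈P)
    ... | no nd   | no ndl   | no ndr    = c , done (c∈P , nd , ndl , ndr)
    descend zero bound c>l l∈P _ = ⊥-elim (ℤP.<-irrefl refl (ℤP.<-≤-trans (GenUpper⇒height< c>l)
      (ℤP.≤-trans bound (ℤP.≤-trans (ℤP.≤-reflexive (ℤP.+-identityʳ b)) (b≤ l∈P)))))
    descend (suc n) bound c>l l∈P extend with go n _ l∈P (fuel-step b n (GenUpper⇒height< c>l) bound)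
    ... | m , l↘m = m , extend l↘m

  Descent⇒minimal : ∀ {c m} → Descent c m → IsMinimal m
  Descent⇒minimal (done m-min)               = m-min
  Descent⇒minimal (viaDown _ des)            = Descent⇒minimal des
  Descent⇒minimal (viaDownLeft _ _ des)      = Descent⇒minimal des
  Descent⇒minimal (viaDownRight _ _ _ des)   = Descent⇒minimal des

  Descent⇒↗ : ∀ {c m} → c ∈ P → Descent c m → m ↗ c
  Descent⇒↗ c∈P (done _)                       = stay
  Descent⇒↗ c∈P (viaDown l∈P des)              = climb (Descent⇒↗ l∈P des) c∈P (GenUpper-down _)
  Descent⇒↗ c∈P (viaDownLeft _ l∈P des)        = climb (Descent⇒↗ l∈P des) c∈P (GenUpper-downLeft _)
  Descent⇒↗ c∈P (viaDownRight _ _ l∈P des)     = climb (Descent⇒↗ l∈P des) c∈P (GenUpper-downRight _)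

  Descent-col : ∀ {m₀ c m} → IsMinimal m₀ → c ∈ P → Descent c m →
    col c ≤ col m₀ + + 1 → col m ≤ col m₀
  Descent-col m₀-min c∈P (done (_ , nd , ndl , _)) c≤ = left-blocked⇒col≤ m₀-min c∈P nd ndl c≤
  Descent-col {c = q , r} m₀-min c∈P (viaDown l∈P des) c≤ = Descent-col m₀-min l∈P des c≤
  Descent-col {c = q , r} m₀-min c∈P (viaDownLeft _ l∈P des) c≤ =
    Descent-col m₀-min l∈P des (ℤP.≤-trans (ℤP.<⇒≤ (i-1<i q)) c≤)
  Descent-col {c = q , r} m₀-min c∈P (viaDownRight nd ndl l∈P des) c≤ =
    Descent-col m₀-min l∈P des (ℤP.+-monoˡ-≤ (+ 1) (left-blocked⇒col≤ m₀-min c∈P nd ndl c≤))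

  minimalCells : List Cell
  minimalCells = filter isMinimal? P

  -- The opaque blocks only stop the type checker from normalising sorted lists and descents.
  opaque
    sources : Enumeration col minimalCells
    sources = enumerate col minimalCells

  open Enumeration sources public renaming (size to k; at to source)

  source-minimal : ∀ i → IsMinimal (source i)
  source-minimal i = proj₂ (∈-filter⁻ isMinimal? {xs = P} (at∈ i))

  source∈P : ∀ i → source i ∈ P
  source∈P i = proj₁ (source-minimal i)

  source-of : ∀ {m} → IsMinimal m → ∃ λ i → source i ≡ m
  source-of m-min with covers (∈-filter⁺ isMinimal? (proj₁ m-min) m-min)
  ... | i , same-col = i , minimal-unique (source-minimal i) m-min same-col

  col-source-≤⇒≤ : ∀ i j → col (source i) ≤ col (source j) → toℕ i ℕ.≤ toℕ j
  col-source-≤⇒≤ i j i≤j with toℕ j ℕ.<? toℕ i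
  ... | yes j<i = ⊥-elim (ℤP.<-irrefl refl (ℤP.<-≤-trans (increasing j i j<i) i≤j))
  ... | no j≮i  = ℕP.≮⇒≥ j≮i

  ReachedBefore : Fin k → Cell → Set
  ReachedBefore j c = ∃ λ i → toℕ i ℕ.< toℕ j × source i ↗ c

  reachedBefore? : ∀ j c → Dec (ReachedBefore j c)
  reachedBefore? j c = FinP.any? (λ i → (toℕ i ℕ.<? toℕ j) ×-dec (source i ↗? c))

  InAnimal : Fin k → Cell → Set
  InAnimal j c = source j ↗ c × ¬ ReachedBefore j c

  inAnimal? : ∀ j c → Dec (InAnimal j c)
  inAnimal? j c = (source j ↗? c) ×-dec ¬? (reachedBefore? j c)

  opaque
    animal : Fin k → List Cell
    animal j = filter (inAnimal? j) P

    animal⁻ : ∀ {j c} → c ∈ animal j → c ∈ P × InAnimal j c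
    animal⁻ {j} = ∈-filter⁻ (inAnimal? j) {xs = P}

    animal⁺ : ∀ {j c} → InAnimal j c → c ∈ animal j
    animal⁺ {j} c-in = ∈-filter⁺ (inAnimal? j) (↗-∈ (source∈P j) (proj₁ c-in)) c-in

  ↗⇒inAnimal : ∀ i {c} → source i ↗ c → ∃ λ j → toℕ j ℕ.≤ toℕ i × InAnimal j c
  ↗⇒inAnimal i {c} = go (toℕ i) i ℕP.≤-refl
    where
    go : ∀ n i → toℕ i ℕ.≤ n → source i ↗ c → ∃ λ j → toℕ j ℕ.≤ toℕ i × InAnimal j c
    go n i i≤n i↗c with reachedBefore? i c
    ... | no ¬before = i , ℕP.≤-refl , i↗c , ¬before
    go zero    i i≤0 _ | yes (i′ , i′<i , _) = ⊥-elim (ℕP.n≮0 (ℕP.<-≤-trans i′<i i≤0))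
    go (suc n) i i≤n _ | yes (i′ , i′<i , i′↗c)
      with go n i′ (ℕP.≤-pred (ℕP.≤-trans i′<i i≤n)) i′↗c
    ... | j , j≤i′ , c-in = j , ℕP.≤-trans j≤i′ (ℕP.<⇒≤ i′<i) , c-in

  reachedBefore⇒earlierAnimal : ∀ {j c} → ReachedBefore j c → ∃ λ i → toℕ i ℕ.< toℕ j × c ∈ animal i
  reachedBefore⇒earlierAnimal (i , i<j , i↗c) with ↗⇒inAnimal i i↗c
  ... | i′ , i′≤i , c-in = i′ , ℕP.≤-<-trans i′≤i i<j , animal⁺ c-in

  source-inAnimal : ∀ j → InAnimal j (source j)
  source-inAnimal j = stay , λ (i , i<j , i↗j) →
    ℤP.<-irrefl (cong col (sym (↗-minimal (source∈P i) (source-minimal j) i↗j))) (increasing i j i<j)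

  animal-rooted : ∀ j → Rooted (animal j) (source j)
  animal-rooted j =
    (animal⁺ (source-inAnimal j) , λ d d∈A → minimal-no-lower (source-minimal j) (proj₁ (animal⁻ d∈A)))
    , lower-in-animal
    where
    lower-in-animal : ∀ c → c ∈ animal j → c ≢ source j → ∃ λ l → l ∈ animal j × GenUpper c l
    lower-in-animal c c∈A c≢s with animal⁻ c∈A
    ... | c∈P , stay , _ = ⊥-elim (c≢s refl)
    ... | c∈P , climb j↗l _ c>l , ¬before =
      _ , animal⁺ (j↗l , λ (i , i<j , i↗l) → ¬before (i , i<j , climb i↗l c∈P c>l)) , c>l

  reachedBefore-↗ : ∀ {j c d} → ReachedBefore j c → c ↗ d → ReachedBefore j d
  reachedBefore-↗ (i , i<j , i↗c) c↗d = i , i<j , ↗-trans i↗c c↗d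

  opaque
    reached-by-source≤ : ∀ j {c} → c ∈ P → col c ≤ col (source j) + + 1 →
      ∃ λ i → toℕ i ℕ.≤ toℕ j × source i ↗ c
    reached-by-source≤ j c∈P c≤ with descent c∈P
    ... | m , c↘m with source-of (Descent⇒minimal c↘m)
    ... | i , refl =
      i , col-source-≤⇒≤ i j (Descent-col (source-minimal j) c∈P c↘m c≤) , Descent⇒↗ c∈P c↘m

  reachedBefore⊎inAnimal : ∀ j {c} → c ∈ P → col c ≤ col (source j) + + 1 → ReachedBefore j c ⊎ InAnimal j c
  reachedBefore⊎inAnimal j {c} c∈P c≤ with reached-by-source≤ j c∈P c≤
  ... | i , i≤j , i↗c with ℕP.m≤n⇒m<n∨m≡n i≤j
  ... | inj₁ i<j = inj₁ (i , i<j , i↗c)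
  ... | inj₂ i≡j with FinP.toℕ-injective i≡j
  ... | refl with reachedBefore? i c
  ... | yes before = inj₁ before
  ... | no ¬before = inj₂ (i↗c , ¬before)

  ¬reachedBefore⇒inAnimal : ∀ j {c} → c ∈ P → col c ≤ col (source j) + + 1 → ¬ ReachedBefore j c →
    InAnimal j c
  ¬reachedBefore⇒inAnimal j c∈P c≤ ¬before with reachedBefore⊎inAnimal j c∈P c≤
  ... | inj₁ before = ⊥-elim (¬before before)
  ... | inj₂ c-in   = c-in

  animal-right-of-source : ∀ i j → suc (toℕ i) ≡ toℕ j → ∀ {c} → InAnimal j c →
    col (source i) + + 1 + + 1 ≤ col c
  animal-right-of-source i j i+1≡j (j↗c , ¬before) = ≰⇒+1≤ λ c≤ →
    let (i′ , i′≤i , i′↗c) = reached-by-source≤ i (↗-∈ (source∈P j) j↗c) c≤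
    in ¬before (i′ , ℕP.≤-<-trans i′≤i (ℕP.≤-reflexive i+1≡j) , i′↗c)

  Frontier : Fin k → Set
  Frontier j = ∃₂ λ c d → ReachedBefore j c × InAnimal j d × Adjacent c d

  upward-frontier : ∀ j {y r} n → y ≤ col (source j) + + 1 → InAnimal j (y , r) →
    (y , r + + n) ∈ P → ReachedBefore j (y , r + + n) → Frontier j
  upward-frontier j {y} {r} n y≤ r-in top∈P top-before
    with first-crossing (λ m → ReachedBefore j (y , r + + m)) (λ m → reachedBefore? j (y , r + + m)) n
           (subst (λ t → ¬ ReachedBefore j (y , t)) (sym (ℤP.+-identityʳ r)) (proj₂ r-in)) top-before
  ... | m , m<n , ¬before , before =
    _ , _ , before , m-in , inj₁ (inj₂ (inj₁ (cong (y ,_) (i+suc[n]≡i+n+1 r m))))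
    where
    m∈P : (y , r + + m) ∈ P
    m∈P = column-interval (↗-∈ (source∈P j) (proj₁ r-in)) top∈P (ℤP.i≤i+j r (+ m))
                          (ℤP.+-monoʳ-≤ r (ℤ.+≤+ (ℕP.<⇒≤ m<n)))
    m-in : InAnimal j (y , r + + m)
    m-in = ¬reachedBefore⇒inAnimal j m∈P y≤ ¬before

  column-frontier : ∀ j {y r r′} → y ≤ col (source j) + + 1 → InAnimal j (y , r) →
    (y , r′) ∈ P → ReachedBefore j (y , r′) → Frontier j
  column-frontier j {y} {r} {r′} y≤ r-in r′∈P r′-before with ℤP.≤-total r′ r
  ... | inj₁ r′≤r = ⊥-elim (proj₂ r-in (reachedBefore-↗ r′-before
                      (column-↗ r′∈P (↗-∈ (source∈P j) (proj₁ r-in)) r′≤r)))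
  ... | inj₂ r≤r′ with ≤⇒≡+ r≤r′
  ... | n , refl = upward-frontier j n y≤ r-in r′∈P r′-before

  leftmost-cell : ∀ j → ∃ λ a → InAnimal j a × (∀ {c} → InAnimal j c → col a ≤ col c)
  leftmost-cell j =
    a , proj₂ (animal⁻ a∈A)
      , λ c-in → All.lookup (Extrema.f[argmin]≤f[xs] (source j) (animal j)) (animal⁺ c-in)
    where
    a = Extrema.argmin col (source j) (animal j)
    a∈A = argmin∈ col (animal j) (animal⁺ (source-inAnimal j))

  -- A path from the previous source to the leftmost column y of the animal crosses from y - 1 into y.
  -- The cell left of the crossing was reached earlier; if the cell right of it was too, climbing
  -- column y from the animal's leftmost cell meets an earlier animal.
  leftmost-frontier : ∀ {j} p → suc (toℕ p) ≡ toℕ j → ∀ {y r} → InAnimal j (y , r) →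
    (∀ {c} → InAnimal j c → y ≤ col c) → y ≤ col (source j) + + 1 → Frontier j
  leftmost-frontier {j} p p+1≡j {y} a-in leftmost-a y≤
    with crossing {y - + 1} (connected _ _ (source∈P p) (↗-∈ (source∈P j) (proj₁ a-in))) (source∈P p)
           (ℤP.≤-trans (i≤i+1 _) (<⇒≤-1 (+1≤⇒< (animal-right-of-source p j p+1≡j a-in)))) (i-1<i y)
  ... | u , (_ , rv) , u∈P , v∈P , u-col , v-col , adj with trans v-col (i-1+1≡i y)
  ... | refl
    with reachedBefore⊎inAnimal j u∈P
           (subst (_≤ col (source j) + + 1) (sym u-col) (ℤP.≤-trans (ℤP.<⇒≤ (i-1<i y)) y≤))
  ... | inj₂ u-in     =
    ⊥-elim (ℤP.<-irrefl refl (ℤP.<-≤-trans (i-1<i y) (subst (y ≤_) u-col (leftmost-a u-in))))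
  ... | inj₁ u-before with reachedBefore⊎inAnimal j v∈P y≤
  ...   | inj₂ v-in     = u , _ , u-before , v-in , adj
  ...   | inj₁ v-before = column-frontier j y≤ a-in v∈P v-before

  frontier : ∀ j → 1 ℕ.≤ toℕ j → Frontier j
  frontier j 1≤j with leftmost-cell j
  ... | a , a-in , leftmost-a = leftmost-frontier (Fin.pred j) (suc-toℕ-pred j 1≤j) a-in leftmost-a
    (ℤP.≤-trans (leftmost-a (source-inAnimal j)) (i≤i+1 _))

  animals-disjoint : ∀ i j → i ≢ j → ∀ c → c ∈ animal i → c ∉ animal j
  animals-disjoint i j i≢j c c∈i c∈j with ℕP.<-cmp (toℕ i) (toℕ j)
  ... | tri< i<j _ _ = proj₂ (proj₂ (animal⁻ c∈j)) (i , i<j , proj₁ (proj₂ (animal⁻ c∈i)))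
  ... | tri≈ _ i≡j _ = i≢j (FinP.toℕ-injective i≡j)
  ... | tri> _ _ j<i = proj₂ (proj₂ (animal⁻ c∈i)) (j , j<i , proj₁ (proj₂ (animal⁻ c∈j)))

  animals-cover : ∀ c → (c ∈ P → ∃ λ i → c ∈ animal i) × ((∃ λ i → c ∈ animal i) → c ∈ P)
  animals-cover c = covered , λ (i , c∈i) → proj₁ (animal⁻ c∈i)
    where
    covered : c ∈ P → ∃ λ i → c ∈ animal i
    covered c∈P with descent c∈P
    ... | m , c↘m with source-of (Descent⇒minimal c↘m)
    ... | i , refl with ↗⇒inAnimal i (Descent⇒↗ c∈P c↘m)
    ... | j , _ , c-in = j , animal⁺ c-in

  source-left-of-animal : ∀ i j → suc (toℕ i) ≡ toℕ j →
    ∀ s → IsSource (animal i) s → ∀ c → c ∈ animal j → ProjLeftOf s c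
  source-left-of-animal i j i+1≡j s s-source c c∈j with rooted-source (animal-rooted i) s-source
  ... | refl =
    projections-apart (col (source i)) (col c) (animal-right-of-source i j i+1≡j (proj₂ (animal⁻ c∈j)))

  Earlier : Fin k → CellSet
  Earlier j c = ∃ λ i → (toℕ i ℕ.< toℕ j) × (c ∈ animal i)

  earlier-dominate : ∀ j → 1 ℕ.≤ toℕ j → DominatesSet (Earlier j) (λ c → c ∈ animal j)
  earlier-dominate j 1≤j with frontier j 1≤j
  ... | c , d , c-before , d-in , adj =
    (c , d , reachedBefore⇒earlierAnimal c-before , animal⁺ d-in , c-dominates adj) , not-dominated
    where
    c-dominates : Adjacent c d → Dominates c d
    c-dominates (inj₁ c>d) = 0 , c , c>d , cong (proj₁ c ,_) (sym (ℤP.+-identityʳ (proj₂ c)))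
    c-dominates (inj₂ d>c) = ⊥-elim (proj₂ d-in (reachedBefore-↗ c-before
                                      (climb stay (↗-∈ (source∈P j) (proj₁ d-in)) d>c)))
    not-dominated : ¬ (∃₂ λ c d → c ∈ animal j × Earlier j d × Dominates c d)
    not-dominated (c′ , d′ , c′∈j , (i , i<j , d′∈i) , c′≻d′) with animal⁻ c′∈j | animal⁻ d′∈i
    ... | c′∈P , _ , ¬before | d′∈P , i↗d′ , _ =
      ¬before (i , i<j , ↗-trans i↗d′ (dominates⇒↗ c′∈P d′∈P c′≻d′))

  earlier-shareEdge : ∀ j → 1 ℕ.≤ toℕ j → ShareEdge (Earlier j) (λ c → c ∈ animal j)
  earlier-shareEdge j 1≤j with frontier j 1≤j
  ... | c , d , c-before , d-in , adj = c , d , reachedBefore⇒earlierAnimal c-before , animal⁺ d-in , adj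

mainTheorem1 : (P : List Cell) → IsPolyomino P → ColumnConvex P →
    IsMultiDirected P
mainTheorem1 P (_ , connected) convex =
  k , animal , (λ j → rooted⇒directedAnimal (animal j) (animal-rooted j)) , animals-disjoint , animals-cover
    , source-left-of-animal , earlier-dominate , earlier-shareEdge
  where open ColumnConvexPolyomino P connected convex
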